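{- Let $S\subseteq\mathbb{Z}$ be the set of integers that can be written as $\sum_{n\geq 1}\varepsilon_n\, n!$ for some finitely supported $\varepsilon\in\{ -1,0,1\}^{\mathbb{N}^\star}$ (where $\mathbb{N}^\star$ is the set of positive integers). Then $S$ generates $\mathbb{Z}$, and the Cayley graph $\mathrm{Cay}(\mathbb{Z},S)$ has infinite diameter but does not contain any geodesic ray.
   Context: A graph is a pair $(V,E)$ with $E$ a set of 2-element subsets of $V$ (no loops, no multiple edges), assumed connected and with $V\neq\varnothing$; it need not be locally finite. For a group $G$ and a generating subset $S$ (possibly infinite), the Cayley graph $\mathrm{Cay}(G,S)$ has vertex set $G$, two distinct vertices $g,h$ being adjacent iff $g^{ -1}h\in S\cup S^{ -1}$. The graph distance $d(u,v)$ is the minimal length of a finite path from $u$ to $v$; the diameter is $\sup_{u,v} d(u,v)\in\mathbb{N}\cup\{\infty\}$. A path is a map $\kappa:I\to V$ with $I\subseteq\mathbb{Z}$ a non-empty integer interval and $\{\kappa(n),\kappa(n+1)\}\in E$ whenever $n,n+1\in I$. A path is geodesic if $d(\kappa(m),\kappa(n))=|m-n|$ for all $m,n\in I$. A ray is a path defined on $\mathbb{N}$. -}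

module Defs where

open import Data.Nat using (ℕ; zero; suc; _≤_; _∸_; _!)
open import Data.Integer as ℤ using (ℤ; +_; _+_; _*_; _-_; -_; ∣_∣)
open import Data.List using (List; []; _∷_)
open import Data.List.Relation.Unary.All using (All)
open import Data.Product using (Σ; _×_; ∃; ∃-syntax)
open import Data.Sum using (_⊎_)
open import Relation.Binary.PropositionalEquality using (_≡_; _≢_)
open import Relation.Nullary using (¬_)

Sign : ℤ → Set
Sign e = e ≡ - (+ 1) ⊎ e ≡ + 0 ⊎ e ≡ + 1

-- A finitely supported sequence ε : ℕ* → {-1,0,1} is encoded as a finite list
-- [ε₁, ε₂, …, εₖ] (all later coefficients zero).
-- facSum es k = Σ_i es[i] * (k + i + 1)!
facSum : List ℤ → ℕ → ℤ
facSum [] k = + 0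
facSum (e ∷ es) k = e * + ((suc k) !) + facSum es (suc k)

InS : ℤ → Set
InS z = ∃[ es ] (All Sign es × facSum es 0 ≡ z)

Adj : ℤ → ℤ → Set
Adj g h = g ≢ h × (InS (h - g) ⊎ InS (- (h - g)))

data Walk : ℕ → ℤ → ℤ → Set where
  here : ∀ {u} → Walk 0 u u
  step : ∀ {n u w v} → Adj u w → Walk n w v → Walk (suc n) u v

Dist : ℤ → ℤ → ℕ → Set
Dist u v k = Walk k u v × (∀ j → suc j ≤ k → ¬ Walk j u v)

data Gen (P : ℤ → Set) : ℤ → Set where
  gen-ε   : Gen P (+ 0)
  gen-pos : ∀ {s z} → P s → Gen P z → Gen P (s + z)
  gen-neg : ∀ {s z} → P s → Gen P z → Gen P (- s + z)

Generates : (ℤ → Set) → Set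
Generates P = ∀ z → Gen P z

InfiniteDiameter : Set
InfiniteDiameter = ∀ (N : ℕ) → ∃[ u ] ∃[ v ] (∀ k → k ≤ N → ¬ Walk k u v)

absDiff : ℕ → ℕ → ℕ
absDiff m n = (m ∸ n) Data.Nat.+ (n ∸ m)

IsPath : (ℕ → ℤ) → Set
IsPath κ = ∀ n → Adj (κ n) (κ (suc n))

IsGeodesicRay : (ℕ → ℤ) → Set
IsGeodesicRay κ = IsPath κ × (∀ m n → Dist (κ m) (κ n) (absDiff m n))

-- A walk of length k from u to v in Cay(ℤ, S) amounts to writing v − u = Σ cᵢ i! with every |cᵢ| ≤ k:
-- the coefficients of consecutive steps add up, and conversely a list bounded by k + 1 splits into its
-- list of signs (an element of S) and a list bounded by k.
--
-- Infinite diameter: such a sum is congruent modulo (p+1)! to a number of absolute value at most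
-- k (1! + ⋯ + p!) ≤ 2k p!.  For Q = (2N+1) p! with p = 4N + 1 we have (p+1)! = 2Q, so every integer
-- congruent to Q has absolute value ≥ Q > 2N p!, and d(0, Q) > N.
--
-- No geodesic ray: write κ₂ − κ₀ = Σ dᵢ i! with |dᵢ| ≤ 2 and L coefficients.  For any Σ cᵢ i! with
-- |cᵢ| ≤ k and L ≤ k, add the two expansions from the bottom with carries: the coefficient at i! is
-- at most k + 3 in absolute value, and since (i+1) i! = (i+1)! and i + 1 ≤ 2k + 3 on the first L places,
-- moving ±1 to the next place brings it down to k + 1.  Hence d(κ₀, κₙ) ≤ d(κ₂, κₙ) + 1 = n − 1
-- as soon as n − 2 ≥ L, contradicting geodesicity.

module Submission where

open import Data.Integer as ℤ using (ℤ; +_; -[1+_]; +[1+_]; _+_; _*_; _-_; -_; ∣_∣)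
import Data.Integer.Properties as ℤP
open import Data.Integer.Tactic.RingSolver using (solve-∀)
open import Data.List using (List; []; _∷_; map; length)
open import Data.List.Relation.Unary.All as All using (All; []; _∷_)
open import Data.List.Relation.Unary.All.Properties using (map⁺)
open import Data.Nat as ℕ using (ℕ; zero; suc; _!; s≤s; z≤n) renaming (_≤_ to _≤ℕ_)
import Data.Nat.Properties as ℕP
import Data.Nat.Tactic.RingSolver as ℕSolver
open import Data.Product using (_×_; _,_; proj₁; proj₂; ∃-syntax)
open import Data.Sum using (inj₁; inj₂)
open import Defs
open import Relation.Binary.PropositionalEquality
open import Relation.Nullary using (¬_; yes; no)

weight : ℕ → ℤ
weight m = + (suc m !)

Bounded : ℕ → List ℤ → Set
Bounded k = All (λ c → ∣ c ∣ ≤ℕ k)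

Representable : ℕ → ℤ → Set
Representable k z = ∃[ cs ] (Bounded k cs × facSum cs 0 ≡ z)

Bounded-weaken : ∀ {i j cs} → i ≤ℕ j → Bounded i cs → Bounded j cs
Bounded-weaken i≤j = All.map (λ b → ℕP.≤-trans b i≤j)

+-*-interchange : ∀ a b f x y → (a + b) * f + (x + y) ≡ (a * f + x) + (b * f + y)
+-*-interchange = solve-∀

facSum-neg : ∀ cs m → facSum (map -_ cs) m ≡ - facSum cs m
facSum-neg [] m = refl
facSum-neg (c ∷ cs) m rewrite facSum-neg cs (suc m) = -‿distrib c (weight m) (facSum cs (suc m))
  where
  -‿distrib : ∀ c f x → - c * f + - x ≡ - (c * f + x)
  -‿distrib = solve-∀

Representable-neg : ∀ {k z} → Representable k z → Representable k (- z)
Representable-neg (cs , bs , eq) =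
  map -_ cs , map⁺ (All.map (λ {c} → subst (_≤ℕ _) (sym (ℤP.∣-i∣≡∣i∣ c))) bs) ,
  trans (facSum-neg cs 0) (cong -_ eq)

_⊕_ : List ℤ → List ℤ → List ℤ
[] ⊕ bs = bs
(a ∷ as) ⊕ [] = a ∷ as
(a ∷ as) ⊕ (b ∷ bs) = (a + b) ∷ (as ⊕ bs)

facSum-⊕ : ∀ as bs m → facSum (as ⊕ bs) m ≡ facSum as m + facSum bs m
facSum-⊕ [] bs m = sym (ℤP.+-identityˡ _)
facSum-⊕ (a ∷ as) [] m = sym (ℤP.+-identityʳ _)
facSum-⊕ (a ∷ as) (b ∷ bs) m rewrite facSum-⊕ as bs (suc m) =
  +-*-interchange a b (weight m) (facSum as (suc m)) (facSum bs (suc m))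

Bounded-⊕ : ∀ {i j} as bs → Bounded i as → Bounded j bs → Bounded (i ℕ.+ j) (as ⊕ bs)
Bounded-⊕ [] bs [] ∣bs∣ = Bounded-weaken (ℕP.m≤n+m _ _) ∣bs∣
Bounded-⊕ (a ∷ as) [] ∣as∣ [] = Bounded-weaken (ℕP.m≤m+n _ _) ∣as∣
Bounded-⊕ (a ∷ as) (b ∷ bs) (∣a∣ ∷ ∣as∣) (∣b∣ ∷ ∣bs∣) =
  ℕP.≤-trans (ℤP.∣i+j∣≤∣i∣+∣j∣ a b) (ℕP.+-mono-≤ ∣a∣ ∣b∣) ∷ Bounded-⊕ as bs ∣as∣ ∣bs∣

Representable-+ : ∀ {i j x y} → Representable i x → Representable j y → Representable (i ℕ.+ j) (x + y)
Representable-+ (as , ∣as∣ , refl) (bs , ∣bs∣ , refl) = as ⊕ bs , Bounded-⊕ as bs ∣as∣ ∣bs∣ , facSum-⊕ as bs 0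

∣sign∣≤1 : ∀ {e} → Sign e → ∣ e ∣ ≤ℕ 1
∣sign∣≤1 (inj₁ refl) = s≤s z≤n
∣sign∣≤1 (inj₂ (inj₁ refl)) = z≤n
∣sign∣≤1 (inj₂ (inj₂ refl)) = s≤s z≤n

InS⇒Representable : ∀ {z} → InS z → Representable 1 z
InS⇒Representable (es , signs , eq) = es , All.map ∣sign∣≤1 signs , eq

Adj⇒Representable : ∀ {u w} → Adj u w → Representable 1 (w - u)
Adj⇒Representable (_ , inj₁ s) = InS⇒Representable s
Adj⇒Representable (_ , inj₂ s) =
  subst (Representable 1) (ℤP.neg-involutive _) (Representable-neg (InS⇒Representable s))

difference-telescope : ∀ u w v → (w - u) + (v - w) ≡ v - u
difference-telescope u w v = trans (ℤP.+-comm (w - u) (v - w)) (ℤP.+-minus-telescope v w u)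

Walk⇒Representable : ∀ {k u v} → Walk k u v → Representable k (v - u)
Walk⇒Representable {u = u} here = [] , [] , sym (ℤP.+-inverseʳ u)
Walk⇒Representable (step {u = u} {w} {v} adj walk) =
  subst (Representable _) (difference-telescope u w v)
    (Representable-+ (Adj⇒Representable adj) (Walk⇒Representable walk))

signum : ℤ → ℤ
signum (+ zero) = + 0
signum +[1+ n ] = + 1
signum -[1+ n ] = - (+ 1)

towardZero : ℤ → ℤ
towardZero (+ zero) = + 0
towardZero +[1+ n ] = + n
towardZero -[1+ n ] = - (+ n)

signum+towardZero : ∀ c → c ≡ signum c + towardZero c
signum+towardZero (+ zero) = refl
signum+towardZero +[1+ n ] = refl
signum+towardZero -[1+ zero ] = refl
signum+towardZero -[1+ suc n ] = refl

signum-Sign : ∀ c → Sign (signum c)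
signum-Sign (+ zero) = inj₂ (inj₁ refl)
signum-Sign +[1+ n ] = inj₂ (inj₂ refl)
signum-Sign -[1+ n ] = inj₁ refl

∣towardZero∣≤ : ∀ {k} c → ∣ c ∣ ≤ℕ suc k → ∣ towardZero c ∣ ≤ℕ k
∣towardZero∣≤ (+ zero) _ = z≤n
∣towardZero∣≤ +[1+ n ] (s≤s n≤k) = n≤k
∣towardZero∣≤ -[1+ n ] (s≤s n≤k) = subst (_≤ℕ _) (sym (ℤP.∣-i∣≡∣i∣ (+ n))) n≤k

facSum-signum-towardZero : ∀ cs m → facSum cs m ≡ facSum (map signum cs) m + facSum (map towardZero cs) m
facSum-signum-towardZero [] m = refl
facSum-signum-towardZero (c ∷ cs) m rewrite facSum-signum-towardZero cs (suc m) =
  trans (cong (λ c → c * weight m + _) (signum+towardZero c))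
        (+-*-interchange (signum c) (towardZero c) (weight m) _ _)

Representable-suc⇒S-step : ∀ {k} u v → Representable (suc k) (v - u) → ∃[ w ] (InS (w - u) × Representable k (v - w))
Representable-suc⇒S-step u v (cs , ∣cs∣ , eq) =
  u + a , (map signum cs , map⁺ (All.universal signum-Sign cs) , sym ([u+a]-u≡a u a)) ,
  map towardZero cs , map⁺ (All.map (λ {c} → ∣towardZero∣≤ c) ∣cs∣) , b≡v-[u+a]
  where
  a = facSum (map signum cs) 0
  b = facSum (map towardZero cs) 0
  [u+a]-u≡a : ∀ u a → (u + a) - u ≡ a
  [u+a]-u≡a = solve-∀
  [v-u]-a≡v-[u+a] : ∀ v u a → (v - u) - a ≡ v - (u + a)
  [v-u]-a≡v-[u+a] = solve-∀
  b≡v-[u+a] : b ≡ v - (u + a)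
  b≡v-[u+a] = begin
    b                 ≡⟨ sym ([u+a]-u≡a a b) ⟩
    (a + b) - a       ≡⟨ cong (_- a) (sym (facSum-signum-towardZero cs 0)) ⟩
    facSum cs 0 - a   ≡⟨ cong (_- a) eq ⟩
    (v - u) - a       ≡⟨ [v-u]-a≡v-[u+a] v u a ⟩
    v - (u + a)       ∎
    where open ≡-Reasoning

Bounded0⇒facSum≡0 : ∀ cs m → Bounded 0 cs → facSum cs m ≡ + 0
Bounded0⇒facSum≡0 [] m [] = refl
Bounded0⇒facSum≡0 (c ∷ cs) m (∣c∣≤0 ∷ bs) =
  cong₂ (λ c r → c * weight m + r) (ℤP.∣i∣≡0⇒i≡0 {c} (ℕP.n≤0⇒n≡0 ∣c∣≤0)) (Bounded0⇒facSum≡0 cs (suc m) bs)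

_++ʷ_ : ∀ {i j u v w} → Walk i u v → Walk j v w → Walk (i ℕ.+ j) u w
here ++ʷ q = q
step adj p ++ʷ q = step adj (p ++ʷ q)

InS⇒Walk≤1 : ∀ {u v} → InS (v - u) → ∃[ j ] (j ≤ℕ 1 × Walk j u v)
InS⇒Walk≤1 {u} {v} s with u ℤ.≟ v
... | yes refl = 0 , z≤n , here
... | no u≢v = 1 , ℕP.≤-refl , step (u≢v , inj₁ s) here

Representable⇒Walk : ∀ k {u v} → Representable k (v - u) → ∃[ j ] (j ≤ℕ k × Walk j u v)
Representable⇒Walk zero {u} {v} (cs , ∣cs∣ , eq) =
  0 , z≤n , subst (Walk 0 u) (sym (ℤP.i-j≡0⇒i≡j v u (trans (sym eq) (Bounded0⇒facSum≡0 cs 0 ∣cs∣)))) here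
Representable⇒Walk (suc k) {u} {v} r with Representable-suc⇒S-step u v r
... | w , w-u∈S , rest with InS⇒Walk≤1 w-u∈S | Representable⇒Walk k rest
...   | i , i≤1 , p | j , j≤k , q = i ℕ.+ j , ℕP.+-mono-≤ i≤1 j≤k , p ++ʷ q

1∈S : InS (+ 1)
1∈S = (+ 1 ∷ []) , (inj₂ (inj₂ refl) ∷ []) , refl

Gen-pos : ∀ n → Gen InS (+ n)
Gen-pos zero = gen-ε
Gen-pos (suc n) = gen-pos 1∈S (Gen-pos n)

Gen-neg : ∀ n → Gen InS (- (+ n))
Gen-neg zero = gen-ε
Gen-neg (suc n) = subst (Gen InS) (sym (ℤP.neg-distrib-+ (+ 1) (+ n))) (gen-neg 1∈S (Gen-neg n))

S-generates : Generates InS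
S-generates (+ n) = Gen-pos n
S-generates -[1+ n ] = Gen-neg (suc n)

factorialSum : ℕ → ℕ
factorialSum zero = 0
factorialSum (suc n) = factorialSum n ℕ.+ suc n !

factorialSum≤2*! : ∀ n → factorialSum n ≤ℕ 2 ℕ.* n !
factorialSum≤2*! zero = z≤n
factorialSum≤2*! (suc zero) = s≤s z≤n
factorialSum≤2*! (suc (suc n)) = begin
  factorialSum (suc n) ℕ.+ suc (suc n) ! ≤⟨ ℕP.+-monoˡ-≤ _ (factorialSum≤2*! (suc n)) ⟩
  2 ℕ.* suc n ! ℕ.+ suc (suc n) !        ≤⟨ ℕP.+-monoˡ-≤ _ (ℕP.*-monoˡ-≤ (suc n !) {2} {suc (suc n)} (s≤s (s≤s z≤n))) ⟩
  suc (suc n) ! ℕ.+ suc (suc n) !        ≡⟨ cong (suc (suc n) ! ℕ.+_) (sym (ℕP.+-identityʳ _)) ⟩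
  2 ℕ.* suc (suc n) !                    ∎
  where open ℕP.≤-Reasoning

weight-suc : ∀ m → weight (suc m) ≡ + suc (suc m) * weight m
weight-suc m = ℤP.pos-* (suc (suc m)) (suc m !)

facSum-divisible : ∀ cs m → ∃[ B ] (facSum cs m ≡ B * weight m)
facSum-divisible [] m = + 0 , refl
facSum-divisible (c ∷ cs) m with facSum-divisible cs (suc m)
... | B , eq = c + B * + suc (suc m) , (begin
  c * weight m + facSum cs (suc m)                 ≡⟨ cong (λ x → c * weight m + x) (trans eq (cong (B *_) (weight-suc m))) ⟩
  c * weight m + B * (+ suc (suc m) * weight m)    ≡⟨ factor c B (+ suc (suc m)) (weight m) ⟩
  (c + B * + suc (suc m)) * weight m               ∎)
  where
  open ≡-Reasoning
  factor : ∀ c b s w → c * w + b * (s * w) ≡ (c + b * s) * w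
  factor = solve-∀

uncons : ∀ {k} cs m → Bounded k cs →
  ∃[ c ] ∃[ cs' ] (∣ c ∣ ≤ℕ k × Bounded k cs' × facSum cs m ≡ c * weight m + facSum cs' (suc m))
uncons [] m [] = + 0 , [] , z≤n , [] , refl
uncons (c ∷ cs) m (∣c∣ ∷ ∣cs∣) = c , cs , ∣c∣ , ∣cs∣ , refl

-- The bound says ∣ L ∣ ≤ k ((m+1)! + ⋯ + (m+p)!), written without truncated subtraction.
facSum-split : ∀ {k} p m cs → Bounded k cs →
  ∃[ L ] ∃[ B ] (facSum cs m ≡ L + B * weight (m ℕ.+ p) ×
                 ∣ L ∣ ℕ.+ k ℕ.* factorialSum m ≤ℕ k ℕ.* factorialSum (m ℕ.+ p))
facSum-split zero m cs _ with facSum-divisible cs m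
... | B , eq rewrite ℕP.+-identityʳ m = + 0 , B , trans eq (sym (ℤP.+-identityˡ _)) , ℕP.≤-refl
facSum-split {k} (suc p) m cs ∣cs∣ with uncons cs m ∣cs∣
... | c , cs' , ∣c∣ , ∣cs'∣ , cs≡ with facSum-split p (suc m) cs' ∣cs'∣
... | L , B , cs'≡ , ∣L∣≤ rewrite ℕP.+-suc m p =
  c * weight m + L , B ,
  trans cs≡ (trans (cong (λ x → c * weight m + x) cs'≡) (sym (ℤP.+-assoc (c * weight m) L _))) ,
  (begin
    ∣ c * weight m + L ∣ ℕ.+ k ℕ.* factorialSum m
      ≤⟨ ℕP.+-monoˡ-≤ _ (ℤP.∣i+j∣≤∣i∣+∣j∣ (c * weight m) L) ⟩
    ∣ c * weight m ∣ ℕ.+ ∣ L ∣ ℕ.+ k ℕ.* factorialSum m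
      ≡⟨ cong (λ x → x ℕ.+ ∣ L ∣ ℕ.+ k ℕ.* factorialSum m) (ℤP.∣i*j∣≡∣i∣*∣j∣ c (weight m)) ⟩
    ∣ c ∣ ℕ.* suc m ! ℕ.+ ∣ L ∣ ℕ.+ k ℕ.* factorialSum m
      ≤⟨ ℕP.+-monoˡ-≤ _ (ℕP.+-monoˡ-≤ _ (ℕP.*-monoˡ-≤ (suc m !) ∣c∣)) ⟩
    k ℕ.* suc m ! ℕ.+ ∣ L ∣ ℕ.+ k ℕ.* factorialSum m
      ≡⟨ regroup k (suc m !) ∣ L ∣ (factorialSum m) ⟩
    ∣ L ∣ ℕ.+ k ℕ.* factorialSum (suc m)
      ≤⟨ ∣L∣≤ ⟩
    k ℕ.* factorialSum (suc (m ℕ.+ p)) ∎)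
  where
  open ℕP.≤-Reasoning
  regroup : ∀ k f l s → k ℕ.* f ℕ.+ l ℕ.+ k ℕ.* s ≡ l ℕ.+ k ℕ.* (s ℕ.+ f)
  regroup = ℕSolver.solve-∀

Representable⇒near-multiple : ∀ {k z} p → Representable k z →
  ∃[ B ] (∣ z - B * weight p ∣ ≤ℕ k ℕ.* factorialSum p)
Representable⇒near-multiple {k} p (cs , ∣cs∣ , refl) with facSum-split p 0 cs ∣cs∣
... | L , B , cs≡ , ∣L∣≤ =
  B , ℕP.≤-trans (ℕP.≤-reflexive (cong ∣_∣ residue≡L)) (ℕP.≤-trans (ℕP.m≤m+n ∣ L ∣ _) ∣L∣≤)
  where
  [a+b]-b≡a : ∀ a b → (a + b) - b ≡ a
  [a+b]-b≡a = solve-∀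
  residue≡L : facSum cs 0 - B * weight p ≡ L
  residue≡L = trans (cong (_- B * weight p) cs≡) ([a+b]-b≡a L (B * weight p))

1≤∣1-2i∣ : ∀ i → 1 ≤ℕ ∣ + 1 - + 2 * i ∣
1≤∣1-2i∣ (+ zero) = ℕP.≤-refl
1≤∣1-2i∣ -[1+ n ] = s≤s z≤n
1≤∣1-2i∣ +[1+ n ] = subst (1 ≤ℕ_) (sym ∣1-2[1+n]∣≡) (s≤s z≤n)
  where
  open ≡-Reasoning
  1-2[1+x]≡ : ∀ x → + 1 - + 2 * (+ 1 + x) ≡ - (+ 1 + + 2 * x)
  1-2[1+x]≡ = solve-∀
  ∣1-2[1+n]∣≡ : ∣ + 1 - + 2 * +[1+ n ] ∣ ≡ suc (2 ℕ.* n)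
  ∣1-2[1+n]∣≡ = begin
    ∣ + 1 - + 2 * (+ 1 + + n) ∣  ≡⟨ cong ∣_∣ (1-2[1+x]≡ (+ n)) ⟩
    ∣ - (+ 1 + + 2 * + n) ∣      ≡⟨ ℤP.∣-i∣≡∣i∣ (+ 1 + + 2 * + n) ⟩
    ∣ + 1 + + 2 * + n ∣          ≡⟨ cong (λ x → ∣ + 1 + x ∣) (sym (ℤP.pos-* 2 n)) ⟩
    suc (2 ℕ.* n)                ∎

Q≤∣Q-i*2Q∣ : ∀ Q i → Q ≤ℕ ∣ + Q - i * + (2 ℕ.* Q) ∣
Q≤∣Q-i*2Q∣ Q i = begin
  Q                            ≡⟨ sym (ℕP.*-identityˡ Q) ⟩
  1 ℕ.* Q                      ≤⟨ ℕP.*-monoˡ-≤ Q (1≤∣1-2i∣ i) ⟩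
  ∣ + 1 - + 2 * i ∣ ℕ.* Q      ≡⟨ sym (ℤP.∣i*j∣≡∣i∣*∣j∣ (+ 1 - + 2 * i) (+ Q)) ⟩
  ∣ (+ 1 - + 2 * i) * + Q ∣    ≡⟨ cong ∣_∣ (odd-multiple i (+ Q)) ⟩
  ∣ + Q - i * (+ 2 * + Q) ∣    ≡⟨ cong (λ x → ∣ + Q - i * x ∣) (sym (ℤP.pos-* 2 Q)) ⟩
  ∣ + Q - i * + (2 ℕ.* Q) ∣    ∎
  where
  open ℕP.≤-Reasoning
  odd-multiple : ∀ i q → (+ 1 - + 2 * i) * q ≡ q - i * (+ 2 * q)
  odd-multiple = solve-∀

infiniteDiameter : InfiniteDiameter
infiniteDiameter N = + 0 , + Q , noShortWalk
  where
  r = suc (2 ℕ.* N)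
  p = r ℕ.+ 2 ℕ.* N
  Q = r ℕ.* p !
  weight-p : weight p ≡ + (2 ℕ.* Q)
  weight-p = cong +_ (trans (cong (ℕ._* p !) (1+p≡2r N)) (ℕP.*-assoc 2 r (p !)))
    where
    1+p≡2r : ∀ N → suc (suc (2 ℕ.* N) ℕ.+ 2 ℕ.* N) ≡ 2 ℕ.* suc (2 ℕ.* N)
    1+p≡2r = ℕSolver.solve-∀
  noShortWalk : ∀ k → k ≤ℕ N → ¬ Walk k (+ 0) (+ Q)
  noShortWalk k k≤N walk with Representable⇒near-multiple p (Walk⇒Representable walk)
  ... | B , near = ℕP.<⇒≱ residue<Q (Q≤∣Q-i*2Q∣ Q B)
    where
    residue<Q : ∣ + Q - B * + (2 ℕ.* Q) ∣ ℕ.< Q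
    residue<Q = begin-strict
      ∣ + Q - B * + (2 ℕ.* Q) ∣  ≡⟨ cong (λ w → ∣ + Q - B * w ∣) (sym weight-p) ⟩
      ∣ + Q - B * weight p ∣      ≡⟨ cong (λ z → ∣ z - B * weight p ∣) (sym (ℤP.+-identityʳ (+ Q))) ⟩
      ∣ (+ Q - + 0) - B * weight p ∣ ≤⟨ near ⟩
      k ℕ.* factorialSum p       ≤⟨ ℕP.*-mono-≤ k≤N (factorialSum≤2*! p) ⟩
      N ℕ.* (2 ℕ.* p !)          ≡⟨ reorder N (p !) ⟩
      2 ℕ.* N ℕ.* p !            <⟨ ℕP.+-monoˡ-≤ (2 ℕ.* N ℕ.* p !) (ℕP.1≤n! p) ⟩
      Q ∎
      where
      open ℕP.≤-Reasoning
      reorder : ∀ N f → N ℕ.* (2 ℕ.* f) ≡ 2 ℕ.* N ℕ.* f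
      reorder = ℕSolver.solve-∀

∣+a-+b∣≤ : ∀ {a b c} → a ≤ℕ b ℕ.+ c → b ≤ℕ a ℕ.+ c → ∣ + a - + b ∣ ≤ℕ c
∣+a-+b∣≤ {a} {b} a≤b+c b≤a+c rewrite ℤP.[+m]-[+n]≡m⊖n a b with ℕP.≤-total a b
... | inj₁ a≤b rewrite ℤP.∣⊖∣-≤ a≤b = ℕP.m≤n+o⇒m∸n≤o b a b≤a+c
... | inj₂ b≤a rewrite ℤP.∣m⊖n∣≡∣n⊖m∣ a b | ℤP.∣⊖∣-≤ b≤a = ℕP.m≤n+o⇒m∸n≤o a b a≤b+c

reduce-ℕdigit : ∀ K m n → n ≤ℕ 3 ℕ.+ K → m ≤ℕ suc (K ℕ.+ K) →
  ∃[ t ] (∣ t ∣ ≤ℕ 1 × ∣ + n - t * + suc (suc m) ∣ ≤ℕ suc K)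
reduce-ℕdigit K m n n≤3+K m≤ with n ℕP.≤? suc K
... | yes n≤1+K = + 0 , z≤n , subst (_≤ℕ suc K) (cong ∣_∣ (sym (ℤP.+-identityʳ (+ n)))) n≤1+K
... | no n≰1+K = + 1 , ℕP.≤-refl ,
  subst (_≤ℕ suc K) (cong (λ x → ∣ + n - x ∣) (sym (ℤP.*-identityˡ (+ suc (suc m))))) (∣+a-+b∣≤ n≤M+1+K M≤n+1+K)
  where
  n≤M+1+K : n ≤ℕ suc (suc m) ℕ.+ suc K
  n≤M+1+K = ℕP.≤-trans n≤3+K (s≤s (s≤s (ℕP.m≤n+m (suc K) m)))
  M≤n+1+K : suc (suc m) ≤ℕ n ℕ.+ suc K
  M≤n+1+K = begin
    suc (suc m)                ≤⟨ s≤s (s≤s m≤) ⟩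
    suc (suc (suc (K ℕ.+ K)))  ≡⟨ cong (λ x → suc (suc x)) (sym (ℕP.+-suc K K)) ⟩
    suc (suc K) ℕ.+ suc K      ≤⟨ ℕP.+-monoˡ-≤ (suc K) (ℕP.≰⇒> n≰1+K) ⟩
    n ℕ.+ suc K                ∎
    where open ℕP.≤-Reasoning

reduce-digit : ∀ K m x → ∣ x ∣ ≤ℕ 3 ℕ.+ K → m ≤ℕ suc (K ℕ.+ K) →
  ∃[ t ] (∣ t ∣ ≤ℕ 1 × ∣ x - t * + suc (suc m) ∣ ≤ℕ suc K)
reduce-digit K m (+ n) = reduce-ℕdigit K m n
reduce-digit K m -[1+ n ] ∣x∣≤ m≤ with reduce-ℕdigit K m (suc n) ∣x∣≤ m≤
... | t , ∣t∣≤1 , reduced =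
  - t , subst (_≤ℕ 1) (sym (ℤP.∣-i∣≡∣i∣ t)) ∣t∣≤1 ,
  subst (_≤ℕ suc K)
    (trans (sym (ℤP.∣-i∣≡∣i∣ (+ suc n - t * + suc (suc m)))) (cong ∣_∣ (neg-residue (+ suc n) t (+ suc (suc m)))))
    reduced
  where
  neg-residue : ∀ x t M → - (x - t * M) ≡ - x - - t * M
  neg-residue = solve-∀

carry : ∀ K m d c t → ∣ t ∣ ≤ℕ 1 → Bounded 2 d → Bounded K c → m ℕ.+ length d ≤ℕ suc (suc (K ℕ.+ K)) →
  ∃[ f ] (Bounded (suc K) f × facSum f m ≡ t * weight m + facSum d m + facSum c m)
carry K m [] c t ∣t∣≤1 [] ∣c∣ _ with uncons c m ∣c∣
... | c₀ , c' , ∣c₀∣ , ∣c'∣ , c≡ =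
  (t + c₀) ∷ c' ,
  ℕP.≤-trans (ℤP.∣i+j∣≤∣i∣+∣j∣ t c₀) (ℕP.+-mono-≤ ∣t∣≤1 ∣c₀∣) ∷ Bounded-weaken (ℕP.n≤1+n K) ∣c'∣ ,
  trans (add-carry t c₀ (weight m) (facSum c' (suc m))) (cong (λ x → t * weight m + + 0 + x) (sym c≡))
  where
  add-carry : ∀ t c w C → (t + c) * w + C ≡ t * w + + 0 + (c * w + C)
  add-carry = solve-∀
carry K m (d₀ ∷ ds) c t ∣t∣≤1 (∣d₀∣ ∷ ∣ds∣) ∣c∣ len≤ with uncons c m ∣c∣
... | c₀ , c' , ∣c₀∣ , ∣c'∣ , c≡ with reduce-digit K m (t + d₀ + c₀) ∣x∣≤ m≤
  where
  ∣x∣≤ : ∣ t + d₀ + c₀ ∣ ≤ℕ 3 ℕ.+ K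
  ∣x∣≤ = ℕP.≤-trans (ℤP.∣i+j∣≤∣i∣+∣j∣ (t + d₀) c₀)
           (ℕP.+-mono-≤ (ℕP.≤-trans (ℤP.∣i+j∣≤∣i∣+∣j∣ t d₀) (ℕP.+-mono-≤ ∣t∣≤1 ∣d₀∣)) ∣c₀∣)
  m≤ : m ≤ℕ suc (K ℕ.+ K)
  m≤ = ℕP.<⇒≤pred (ℕP.<-≤-trans (ℕP.m<m+n m (s≤s z≤n)) len≤)
... | t' , ∣t'∣≤1 , ∣r∣≤
    with carry K (suc m) ds c' t' ∣t'∣≤1 ∣ds∣ ∣c'∣ (ℕP.≤-trans (ℕP.≤-reflexive (sym (ℕP.+-suc m (length ds)))) len≤)
... | f , ∣f∣ , f≡ = (x - t' * M) ∷ f , ∣r∣≤ ∷ ∣f∣ , (begin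
  (x - t' * M) * weight m + facSum f (suc m)
    ≡⟨ cong (λ y → (x - t' * M) * weight m + y) f≡ ⟩
  (x - t' * M) * weight m + (t' * weight (suc m) + D + C)
    ≡⟨ cong (λ w → (x - t' * M) * weight m + (t' * w + D + C)) (weight-suc m) ⟩
  (x - t' * M) * weight m + (t' * (M * weight m) + D + C)
    ≡⟨ carry-out t d₀ c₀ t' M (weight m) D C ⟩
  t * weight m + (d₀ * weight m + D) + (c₀ * weight m + C)
    ≡⟨ cong (λ y → t * weight m + (d₀ * weight m + D) + y) (sym c≡) ⟩
  t * weight m + (d₀ * weight m + D) + facSum c m
    ∎)
  where
  open ≡-Reasoning
  x = t + d₀ + c₀
  M = + suc (suc m)
  D = facSum ds (suc m)
  C = facSum c' (suc m)
  carry-out : ∀ t d c t' M w D C →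
    ((t + d + c) - t' * M) * w + (t' * (M * w) + D + C) ≡ t * w + (d * w + D) + (c * w + C)
  carry-out = solve-∀

Representable-absorb : ∀ {K x y} d → Bounded 2 d → facSum d 0 ≡ x → length d ≤ℕ suc (suc (K ℕ.+ K)) →
  Representable K y → Representable (suc K) (x + y)
Representable-absorb {K} d ∣d∣ refl len≤ (c , ∣c∣ , refl) with carry K 0 d c (+ 0) z≤n ∣d∣ ∣c∣ len≤
... | f , ∣f∣ , f≡ = f , ∣f∣ , trans f≡ (cong (_+ facSum c 0) (ℤP.+-identityˡ (facSum d 0)))

shortcut : ∀ {u v} → Walk 2 u v →
  ∃[ L ] (∀ {k w} → L ≤ℕ k → Walk k v w → ∃[ j ] (j ≤ℕ suc k × Walk j u w))
shortcut {u} {v} uv with Walk⇒Representable uv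
... | d , ∣d∣ , d≡ = length d , λ {k} {w} L≤k vw →
  Representable⇒Walk (suc k)
    (subst (Representable (suc k)) (difference-telescope u v w)
      (Representable-absorb d ∣d∣ d≡ (ℕP.≤-trans L≤k (k≤2k+2 k)) (Walk⇒Representable vw)))
  where
  k≤2k+2 : ∀ k → k ℕ.≤ suc (suc (k ℕ.+ k))
  k≤2k+2 k = ℕP.m≤n⇒m≤1+n (ℕP.m≤n⇒m≤1+n (ℕP.m≤m+n k k))

noGeodesicRay : ¬ (∃[ κ ] IsGeodesicRay κ)
noGeodesicRay (κ , _ , geodesic) =
  let L , detour = shortcut (proj₁ (geodesic 0 2))
      j , j≤1+k , walk = detour (ℕP.n≤1+n L) (proj₁ (geodesic 2 (3 ℕ.+ L)))
  in proj₂ (geodesic 0 (3 ℕ.+ L)) j (s≤s j≤1+k) walk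

mainTheorem2 : Generates InS × InfiniteDiameter × ¬ (∃[ κ ] IsGeodesicRay κ)
mainTheorem2 = S-generates , infiniteDiameter , noGeodesicRay
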